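{- Let $n\ge 1$ and let $G$ be a spanning subgraph of $K_4^n$ that is $C_5$-saturated relative to $K_4^n$ and has exactly $sat(K_4^n,C_5)$ edges. If $C$ is a cycle of $G$ of length $p$ such that no edge of $C$ belongs to any other cycle of $G$, then $p \leq 7$.
   Context: All graphs are finite, simple and undirected. $K_4^n$ denotes the complete $4$-partite graph with exactly $n$ vertices in each part. $C_5$ is the cycle on $5$ vertices; the length of a cycle is its number of vertices. A spanning subgraph $H$ of $G$ is $F$-saturated relative to $G$ if $H$ contains no copy of $F$ but $H+e$ contains a copy of $F$ for every $e\in E(G)\setminus E(H)$; $sat(G,F)$ is the minimum number of edges of such an $H$. -}

module Defs where

open import Data.Nat using (ℕ; zero; suc; _≤_; _/_)
open import Data.Fin using (Fin; toℕ)
open import Data.Bool using (Bool; true; false; T; _∨_)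
open import Data.Product using (Σ; ∃; _×_; _,_; proj₁; proj₂)
open import Data.Sum using (_⊎_)
open import Data.List using (List; length; filterᵇ; cartesianProduct; allFin)
open import Relation.Binary.PropositionalEquality using (_≡_; _≢_)
open import Relation.Nullary using (¬_)
open import Function.Definitions using (Injective)

-- Vertices of K_4^n: (part, index within part)
V : ℕ → Set
V n = Fin 4 × Fin n

KAdj : ∀ {n} → V n → V n → Set
KAdj u v = proj₁ u ≢ proj₁ v

record Graph (n : ℕ) : Set where
  field
    adj    : V n → V n → Bool
    sym    : ∀ u v → adj u v ≡ adj v u
    irrefl : ∀ v → adj v v ≡ false
open Graph public

E : ∀ {n} → Graph n → V n → V n → Set
E G u v = T (adj G u v)

Spanning : ∀ {n} → Graph n → Set
Spanning G = ∀ u v → E G u v → KAdj u v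

Consec : (p : ℕ) → Fin p → Fin p → Set
Consec p i j = (suc (toℕ i) ≡ toℕ j) ⊎ ((suc (toℕ i) ≡ p) × (toℕ j ≡ 0))

IsCycle : ∀ {A : Set} → (A → A → Set) → (p : ℕ) → (Fin p → A) → Set
IsCycle R p f = (3 ≤ p) × Injective _≡_ _≡_ f × (∀ i j → Consec p i j → R (f i) (f j))

CycEdge : ∀ {A : Set} {p : ℕ} → (Fin p → A) → A → A → Set
CycEdge {p = p} f u v =
  Σ (Fin p) λ i → Σ (Fin p) λ j → Consec p i j ×
    (((f i ≡ u) × (f j ≡ v)) ⊎ ((f i ≡ v) × (f j ≡ u)))

HasC5 : ∀ {A : Set} → (A → A → Set) → Set
HasC5 {A} R = Σ (Fin 5 → A) λ f → IsCycle R 5 f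

AddEdge : ∀ {A : Set} → (A → A → Set) → A → A → (A → A → Set)
AddEdge R u v x y = R x y ⊎ ((x ≡ u) × (y ≡ v)) ⊎ ((x ≡ v) × (y ≡ u))

Saturated : ∀ {n} → Graph n → Set
Saturated H = ¬ HasC5 (E H) × (∀ u v → KAdj u v → ¬ E H u v → HasC5 (AddEdge (E H) u v))

allV : ∀ n → List (V n)
allV n = cartesianProduct (allFin 4) (allFin n)

numEdges : ∀ {n} → Graph n → ℕ
numEdges {n} G =
  length (filterᵇ (λ uv → adj G (proj₁ uv) (proj₂ uv)) (cartesianProduct (allV n) (allV n))) / 2

-- Suppose the isolated cycle C = F 0, F 1, … had length at least 8.  A cycle of G sharing an edge
-- with C has exactly the edges of C, while a chord of C, or an ear (a path between two vertices of
-- C with all inner vertices off C), closed up by an arc of C is a cycle sharing an edge with C but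
-- containing an edge outside C.  So C has neither, and every path of G between two vertices of C
-- runs along C without turning back: a path of length 4 joins vertices at cyclic distance 4.
-- Now F 2 F 3 is an edge, so F 0 lies in another part than F k for k = 2 or k = 3.  The edge
-- F 0 F k would be a chord, and otherwise saturation gives a C₅ through F 0 F k, i.e. a path of
-- length 4 from F 0 to F k; both are impossible.
module Submission where

open import Data.Bool using (T)
open import Data.Empty using (⊥; ⊥-elim)
open import Data.Fin using (Fin; toℕ; fromℕ; fromℕ<) renaming (zero to fzero)
open import Data.Fin.Properties using (toℕ-injective; toℕ<n; toℕ-fromℕ; toℕ-fromℕ<; any?) renaming (_≟_ to _≟ᶠ_)
open import Data.Nat using (ℕ; zero; suc; _+_; _∸_; _≤_; _<_; z≤n; s≤s; s≤s⁻¹; _≤?_)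
open import Data.Nat.DivMod using (_mod_; m≤n⇒m%n≡m)
open import Data.Nat.Properties
open import Data.Product using (∃-syntax; _×_; _,_; proj₁; proj₂)
open import Data.Product.Properties using (≡-dec)
open import Data.Sum using (_⊎_; inj₁; inj₂)
open import Function using (_∘_)
open import Relation.Binary.Definitions using (tri<; tri≈; tri>)
open import Relation.Binary.PropositionalEquality using (_≡_; _≢_; refl; sym; trans; cong; subst; subst₂)
open import Relation.Nullary using (¬_; Dec; yes; no)
open import Relation.Nullary.Decidable using (¬?; T?; decidable-stable; _×-dec_; _⊎-dec_)
open import Relation.Unary using (Decidable)

open import Defs hiding (sym)

first-hit : ∀ {P : ℕ → Set} → Decidable P → ∀ s k → P (s + k) →
            ∃[ d ] d ≤ k × P (s + d) × (∀ {e} → e < d → ¬ P (s + e))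
first-hit P? s zero    Ps+k = 0 , z≤n , Ps+k , λ ()
first-hit {P} P? s (suc k) Ps+k with P? (s + 0)
... | yes Ps = 0 , z≤n , Ps , λ ()
... | no ¬Ps with first-hit P? (suc s) k (subst P (+-suc s k) Ps+k)
...   | d , d≤k , Pd , before = suc d , s≤s d≤k , subst P (sym (+-suc s d)) Pd , earlier
  where
  earlier : ∀ {e} → e < suc d → ¬ P (s + e)
  earlier {zero}  _         = ¬Ps
  earlier {suc e} (s≤s e<d) = before e<d ∘ subst P (+-suc s e)

-- Walks on the cycle ℤ/p

-- Consec p i j is definitionally CyclicSucc p (toℕ i) (toℕ j).
CyclicSucc : ℕ → ℕ → ℕ → Set
CyclicSucc p x y = suc x ≡ y ⊎ (suc x ≡ p × y ≡ 0)

CyclicAdj : ℕ → ℕ → ℕ → Set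
CyclicAdj p x y = CyclicSucc p x y ⊎ CyclicSucc p y x

cyclicAdj? : ∀ q a b → Dec (CyclicAdj q a b)
cyclicAdj? q a b = cyclicSucc? a b ⊎-dec cyclicSucc? b a
  where
  cyclicSucc? : ∀ x y → Dec (CyclicSucc q x y)
  cyclicSucc? x y = (suc x ≟ y) ⊎-dec ((suc x ≟ q) ×-dec (y ≟ 0))

not-adjacent-to-0 : ∀ {p k} → 2 ≤ k → k < p → ¬ CyclicAdj (suc p) 0 k
not-adjacent-to-0 (s≤s (s≤s _)) _   (inj₁ (inj₁ ()))
not-adjacent-to-0 (s≤s (s≤s _)) _   (inj₁ (inj₂ (_ , ())))
not-adjacent-to-0 _             k<p (inj₂ (inj₂ (1+k≡1+p , _))) = <-irrefl (suc-injective 1+k≡1+p) k<p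

module _ {p : ℕ} where

  cyclicSucc-injectiveˡ : ∀ {x y z} → CyclicSucc p x y → CyclicSucc p z y → x ≡ z
  cyclicSucc-injectiveˡ (inj₁ refl)       (inj₁ e)       = sym (suc-injective e)
  cyclicSucc-injectiveˡ (inj₁ refl)       (inj₂ (_ , ()))
  cyclicSucc-injectiveˡ (inj₂ (_ , refl)) (inj₁ ())
  cyclicSucc-injectiveˡ (inj₂ (e , _))    (inj₂ (e′ , _)) = suc-injective (trans e (sym e′))

  cyclicSucc-injectiveʳ : ∀ {x y z} → y < p → z < p → CyclicSucc p x y → CyclicSucc p x z → y ≡ z
  cyclicSucc-injectiveʳ _   _   (inj₁ e)       (inj₁ e′)      = trans (sym e) e′
  cyclicSucc-injectiveʳ y<p _   (inj₁ refl)    (inj₂ (e , _)) = ⊥-elim (<-irrefl e y<p)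
  cyclicSucc-injectiveʳ _   z<p (inj₂ (e , _)) (inj₁ refl)    = ⊥-elim (<-irrefl e z<p)
  cyclicSucc-injectiveʳ _   _   (inj₂ (_ , e)) (inj₂ (_ , e′)) = trans e (sym e′)

  cyclicSucc⇒≡suc : ∀ {x y} → suc x < p → CyclicSucc p x y → y ≡ suc x
  cyclicSucc⇒≡suc _      (inj₁ e)       = sym e
  cyclicSucc⇒≡suc sx<p   (inj₂ (e , _)) = ⊥-elim (<-irrefl e sx<p)

  cyclicSucc-continues : ∀ {x y z} → CyclicSucc p x y → CyclicAdj p y z → z ≢ x → CyclicSucc p y z
  cyclicSucc-continues _    (inj₁ y→z) _   = y→z
  cyclicSucc-continues x→y (inj₂ z→y) z≢x = ⊥-elim (z≢x (cyclicSucc-injectiveˡ z→y x→y))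

  cyclicPred-continues : ∀ {x y z} → x < p → z < p → CyclicSucc p y x → CyclicAdj p y z → z ≢ x →
                         CyclicSucc p z y
  cyclicPred-continues x<p z<p y→x (inj₁ y→z) z≢x = ⊥-elim (z≢x (sym (cyclicSucc-injectiveʳ x<p z<p y→x y→z)))
  cyclicPred-continues _   _   _   (inj₂ z→y) _   = z→y

  forward-walk-position : ∀ {m} (x : ℕ → ℕ) → (∀ {t} → t < m → CyclicSucc p (x t) (x (suc t))) →
                          x 0 + m < p → ∀ {t} → t ≤ m → x t ≡ x 0 + t
  forward-walk-position x step bound {zero}  _   = sym (+-identityʳ (x 0))
  forward-walk-position x step bound {suc t} t<m =
    trans (cyclicSucc⇒≡suc (subst (_< p) (sym sxt) (≤-<-trans (+-monoʳ-≤ (x 0) t<m) bound)) (step t<m)) sxt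
    where
    sxt : suc (x t) ≡ x 0 + suc t
    sxt = trans (cong suc (forward-walk-position x step bound (<⇒≤ t<m))) (sym (+-suc (x 0) t))

record NonBacktrackingWalk (p m : ℕ) (x : ℕ → ℕ) : Set where
  field
    bounded          : ∀ {t} → t ≤ m → x t < p
    adjacent         : ∀ {t} → t < m → CyclicAdj p (x t) (x (suc t))
    non-backtracking : ∀ {t} → suc t < m → x (suc (suc t)) ≢ x t

module _ {p m : ℕ} {x : ℕ → ℕ} (walk : NonBacktrackingWalk p m x) where
  open NonBacktrackingWalk walk

  keeps-forward : CyclicSucc p (x 0) (x 1) → ∀ {t} → t < m → CyclicSucc p (x t) (x (suc t))
  keeps-forward x₀→x₁ {zero}  _    = x₀→x₁
  keeps-forward x₀→x₁ {suc t} st<m =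
    cyclicSucc-continues (keeps-forward x₀→x₁ (<-trans (n<1+n t) st<m)) (adjacent st<m) (non-backtracking st<m)

  keeps-backward : CyclicSucc p (x 1) (x 0) → ∀ {t} → t < m → CyclicSucc p (x (suc t)) (x t)
  keeps-backward x₁→x₀ {zero}  _    = x₁→x₀
  keeps-backward x₁→x₀ {suc t} st<m =
    cyclicPred-continues (bounded (<⇒≤ (<-trans (n<1+n t) st<m))) (bounded st<m)
      (keeps-backward x₁→x₀ (<-trans (n<1+n t) st<m)) (adjacent st<m) (non-backtracking st<m)

  backward-walk-position : CyclicSucc p (x 1) (x 0) → x m + m < p → x 0 ≡ x m + m
  backward-walk-position x₁→x₀ bound =
    trans (cong x (sym (n∸n≡0 m))) (forward-walk-position (λ t → x (m ∸ t)) reversed-step bound ≤-refl)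
    where
    reversed-step : ∀ {t} → t < m → CyclicSucc p (x (m ∸ t)) (x (m ∸ suc t))
    reversed-step {t} t<m = subst (λ i → CyclicSucc p (x i) (x (m ∸ suc t))) (sym m∸t≡1+m∸1+t)
      (keeps-backward x₁→x₀ (subst (_≤ m) m∸t≡1+m∸1+t (m∸n≤m m t)))
      where
      m∸t≡1+m∸1+t : m ∸ t ≡ suc (m ∸ suc t)
      m∸t≡1+m∸1+t = +-∸-assoc 1 t<m

walk-displacement : ∀ {p m x} → NonBacktrackingWalk p m x → x 0 + m < p → x m + m < p →
                    x m ≡ x 0 + m ⊎ x 0 ≡ x m + m
walk-displacement {m = zero}  {x} _    _       _       = inj₁ (sym (+-identityʳ (x 0)))
walk-displacement {m = suc m} walk bound₀ bound₁ with NonBacktrackingWalk.adjacent walk {0} (s≤s z≤n)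
... | inj₁ x₀→x₁ = inj₁ (forward-walk-position _ (keeps-forward walk x₀→x₁) bound₀ ≤-refl)
... | inj₂ x₁→x₀ = inj₂ (backward-walk-position walk x₁→x₀ bound₁)

-- Paths

record Path {A : Set} (R : A → A → Set) (x y : A) (m : ℕ) : Set where
  field
    at           : ℕ → A
    at-start     : at 0 ≡ x
    at-end       : at m ≡ y
    at-injective : ∀ {s t} → s ≤ m → t ≤ m → at s ≡ at t → s ≡ t
    at-step      : ∀ {t} → t < m → R (at t) (at (suc t))
open Path

glue : {A : Set} → ℕ → (ℕ → A) → (ℕ → A) → ℕ → A
glue zero    f g t       = g t
glue (suc m) f g zero    = f zero
glue (suc m) f g (suc t) = glue m (f ∘ suc) g t

module _ {A : Set} where

  glue-< : ∀ m (f g : ℕ → A) {t} → t < m → glue m f g t ≡ f t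
  glue-< (suc m) f g {zero}  _         = refl
  glue-< (suc m) f g {suc t} (s≤s t<m) = glue-< m (f ∘ suc) g t<m

  glue-+ : ∀ m (f g : ℕ → A) t → glue m f g (m + t) ≡ g t
  glue-+ zero    f g t = refl
  glue-+ (suc m) f g t = glue-+ m (f ∘ suc) g t

  glue-≤ : ∀ m (f g : ℕ → A) → f m ≡ g 0 → ∀ {t} → t ≤ m → glue m f g t ≡ f t
  glue-≤ m f g meet t≤m with m≤n⇒m<n∨m≡n t≤m
  ... | inj₁ t<m  = glue-< m f g t<m
  ... | inj₂ refl = trans (cong (glue m f g) (sym (+-identityʳ m))) (trans (glue-+ m f g 0) (sym meet))

split-at : ∀ m t → t < m ⊎ ∃[ d ] t ≡ m + d
split-at zero    t       = inj₂ (t , refl)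
split-at (suc m) zero    = inj₁ (s≤s z≤n)
split-at (suc m) (suc t) with split-at m t
... | inj₁ t<m      = inj₁ (s≤s t<m)
... | inj₂ (d , eq) = inj₂ (d , cong suc eq)

module _ {A : Set} {R S : A → A → Set} where

  restrict : ∀ {x y m} (P : Path R x y m) →
             (∀ {t} → t < m → S (at P t) (at P (suc t))) → Path S x y m
  restrict P steps = record
    { at = at P ; at-start = at-start P ; at-end = at-end P ; at-injective = at-injective P ; at-step = steps }

module _ {A : Set} {R : A → A → Set} where

  cast : ∀ {x x′ y y′ m} → x ≡ x′ → y ≡ y′ → Path R x y m → Path R x′ y′ m
  cast x≡x′ y≡y′ P = record
    { at = at P ; at-start = trans (at-start P) x≡x′ ; at-end = trans (at-end P) y≡y′
    ; at-injective = at-injective P ; at-step = at-step P }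

  reverse : (∀ {a b} → R a b → R b a) → ∀ {x y m} → Path R x y m → Path R y x m
  reverse R-sym {m = m} P = record
    { at           = λ t → at P (m ∸ t)
    ; at-start     = at-end P
    ; at-end       = trans (cong (at P) (n∸n≡0 m)) (at-start P)
    ; at-injective = λ {s} {t} s≤m t≤m eq →
                       ∸-cancelˡ-≡ s≤m t≤m (at-injective P (m∸n≤m m s) (m∸n≤m m t) eq)
    ; at-step      = step
    }
    where
    step : ∀ {t} → t < m → R (at P (m ∸ t)) (at P (m ∸ suc t))
    step {t} t<m = subst (λ i → R (at P i) (at P (m ∸ suc t))) (sym m∸t≡1+m∸1+t)
      (R-sym (at-step P (subst (_≤ m) m∸t≡1+m∸1+t (m∸n≤m m t))))
      where
      m∸t≡1+m∸1+t : m ∸ t ≡ suc (m ∸ suc t)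
      m∸t≡1+m∸1+t = +-∸-assoc 1 t<m

  slice : ∀ {x y m} (P : Path R x y m) a d → a + d ≤ m → Path R (at P a) (at P (a + d)) d
  slice {m = m} P a d a+d≤m = record
    { at           = λ t → at P (a + t)
    ; at-start     = cong (at P) (+-identityʳ a)
    ; at-end       = refl
    ; at-injective = λ s≤d t≤d eq → +-cancelˡ-≡ a _ _ (at-injective P (bound s≤d) (bound t≤d) eq)
    ; at-step      = λ {t} t<d → subst (λ i → R (at P (a + t)) (at P i)) (sym (+-suc a t))
                       (at-step P (subst (_≤ m) (+-suc a t) (bound t<d)))
    }
    where
    bound : ∀ {t} → t ≤ d → a + t ≤ m
    bound t≤d = ≤-trans (+-monoʳ-≤ a t≤d) a+d≤m

  edge : ∀ {x y} → x ≢ y → R x y → Path R x y 1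
  edge {x} {y} x≢y xy = record
    { at           = ends
    ; at-start     = refl
    ; at-end       = refl
    ; at-injective = injective
    ; at-step      = λ { {zero} _ → xy ; {suc _} (s≤s ()) }
    }
    where
    ends : ℕ → A
    ends zero    = x
    ends (suc _) = y
    injective : ∀ {s t} → s ≤ 1 → t ≤ 1 → ends s ≡ ends t → s ≡ t
    injective {zero}  {zero}  _ _ _ = refl
    injective {zero}  {suc _} _ (s≤s z≤n) eq = ⊥-elim (x≢y eq)
    injective {suc _} {zero}  (s≤s z≤n) _ eq = ⊥-elim (x≢y (sym eq))
    injective {suc _} {suc _} (s≤s z≤n) (s≤s z≤n) _ = refl

  ends-distinct : ∀ {x y m} → Path R x y (suc m) → x ≢ y
  ends-distinct P x≡y = 0≢1+n (at-injective P z≤n ≤-refl (trans (at-start P) (trans x≡y (sym (at-end P)))))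

  Disjoint : ∀ {x y z m k} → Path R x y m → Path R y z k → Set
  Disjoint {m = m} {k} P Q = ∀ {s t} → s < m → 0 < t → t ≤ k → at P s ≢ at Q t

  concat : ∀ {x y z m k} (P : Path R x y m) (Q : Path R y z k) → Disjoint P Q → Path R x z (m + k)
  concat {m = m} {k} P Q disjoint = record
    { at           = h
    ; at-start     = trans (h-left z≤n) (at-start P)
    ; at-end       = trans (h-right k) (at-end Q)
    ; at-injective = injective
    ; at-step      = step
    }
    where
    h : ℕ → A
    h = glue m (at P) (at Q)
    meet : at P m ≡ at Q 0
    meet = trans (at-end P) (sym (at-start Q))
    h-left : ∀ {t} → t ≤ m → h t ≡ at P t
    h-left = glue-≤ m (at P) (at Q) meet
    h-right : ∀ d → h (m + d) ≡ at Q d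
    h-right = glue-+ m (at P) (at Q)
    apart : ∀ {s d} → s < m → d ≤ k → at P s ≢ at Q d
    apart {s} {zero}  s<m _   eq = <-irrefl (at-injective P (<⇒≤ s<m) ≤-refl (trans eq (sym meet))) s<m
    apart {s} {suc d} s<m d≤k eq = disjoint s<m (s≤s z≤n) d≤k eq
    injective : ∀ {s t} → s ≤ m + k → t ≤ m + k → h s ≡ h t → s ≡ t
    injective {s} {t} s≤ t≤ eq with split-at m s | split-at m t
    ... | inj₁ s<m | inj₁ t<m =
      at-injective P (<⇒≤ s<m) (<⇒≤ t<m) (trans (sym (h-left (<⇒≤ s<m))) (trans eq (h-left (<⇒≤ t<m))))
    ... | inj₁ s<m | inj₂ (d , refl) =
      ⊥-elim (apart s<m (+-cancelˡ-≤ m d k t≤) (trans (sym (h-left (<⇒≤ s<m))) (trans eq (h-right d))))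
    ... | inj₂ (d , refl) | inj₁ t<m =
      ⊥-elim (apart t<m (+-cancelˡ-≤ m d k s≤) (trans (sym (h-left (<⇒≤ t<m))) (trans (sym eq) (h-right d))))
    ... | inj₂ (d , refl) | inj₂ (d′ , refl) =
      cong (m +_) (at-injective Q (+-cancelˡ-≤ m d k s≤) (+-cancelˡ-≤ m d′ k t≤)
        (trans (sym (h-right d)) (trans eq (h-right d′))))
    step : ∀ {t} → t < m + k → R (h t) (h (suc t))
    step {t} t< with split-at m t
    ... | inj₁ t<m       = subst₂ R (sym (h-left (<⇒≤ t<m))) (sym (h-left t<m)) (at-step P t<m)
    ... | inj₂ (d , refl) = subst₂ R (sym (h-right d)) (sym (trans (cong h (sym (+-suc m d))) (h-right (suc d))))
                              (at-step Q (+-cancelˡ-< m d k t<))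

  at-concatˡ : ∀ {x y z m k} (P : Path R x y m) (Q : Path R y z k) (disjoint : Disjoint P Q) {t} → t ≤ m →
               at (concat P Q disjoint) t ≡ at P t
  at-concatˡ {m = m} P Q _ = glue-≤ m (at P) (at Q) (trans (at-end P) (sym (at-start Q)))

  at-concatʳ : ∀ {x y z m k} (P : Path R x y m) (Q : Path R y z k) (disjoint : Disjoint P Q) t →
               at (concat P Q disjoint) (m + t) ≡ at Q t
  at-concatʳ {m = m} P Q _ = glue-+ m (at P) (at Q)

  -- P followed by the edge y → x is a cycle; read it starting after its t-th step.
  rotate : ∀ {x y m} (P : Path R x y m) → R y x → ∀ {t} → t < m → Path R (at P (suc t)) (at P t) m
  rotate {x} {y} {m} P yx {t} t<m = subst (Path R _ _) length (concat (concat after closing disjoint₁) before disjoint₂)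
    where
    r : ℕ
    r = m ∸ suc t
    1+t+r≡m : suc t + r ≡ m
    1+t+r≡m = m+[n∸m]≡n t<m
    length : r + 1 + t ≡ m
    length = trans (+-assoc r 1 t) (trans (+-comm r (suc t)) 1+t+r≡m)
    index-≤ : ∀ {s} → s ≤ r → suc t + s ≤ m
    index-≤ s≤r = subst (suc t + _ ≤_) 1+t+r≡m (+-monoʳ-≤ (suc t) s≤r)
    after : Path R (at P (suc t)) y r
    after = cast refl (trans (cong (at P) 1+t+r≡m) (at-end P)) (slice P (suc t) r (index-≤ ≤-refl))
    closing : Path R y x 1
    closing = edge (λ y≡x → <-irrefl (sym (at-injective P ≤-refl z≤n (trans (at-end P) (trans y≡x (sym (at-start P))))))
                                     (≤-trans (s≤s z≤n) t<m))
                   yx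
    disjoint₁ : Disjoint after closing
    disjoint₁ {s} {suc _} s<r _ _ eq with at-injective P (index-≤ (<⇒≤ s<r)) z≤n (trans eq (sym (at-start P)))
    ... | ()
    before : Path R x (at P t) t
    before = cast (at-start P) refl (slice P 0 t (<⇒≤ t<m))
    disjoint₂ : Disjoint (concat after closing disjoint₁) before
    disjoint₂ {s} {u} s<r+1 _ u≤t eq = <-irrefl (sym t+1+s≡u) (s≤s (≤-trans u≤t (m≤m+n t s)))
      where
      s≤r : s ≤ r
      s≤r = s≤s⁻¹ (subst (s <_) (+-comm r 1) s<r+1)
      t+1+s≡u : suc t + s ≡ u
      t+1+s≡u = at-injective P (index-≤ s≤r) (≤-trans u≤t (<⇒≤ t<m))
                  (trans (sym (at-concatˡ after closing disjoint₁ s≤r)) eq)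

  module _ {S : A → A → Set} {x y m} (P : Path S x y m) where

    no-step-from-end : ∀ {t} → t < m → at P t ≢ y
    no-step-from-end t<m eq = <-irrefl (at-injective P (<⇒≤ t<m) ≤-refl (trans eq (sym (at-end P)))) t<m

    no-shortcut : 2 ≤ m → ∀ {t} → t < m → at P t ≡ x → at P (suc t) ≢ y
    no-shortcut 2≤m {t} t<m t≡x 1+t≡y with at-injective P (<⇒≤ t<m) z≤n (trans t≡x (sym (at-start P)))
    ... | refl = <-irrefl (at-injective P t<m ≤-refl (trans 1+t≡y (sym (at-end P)))) 2≤m

  drop-added-edge : (∀ {a b} → R a b → R b a) → ∀ {u v x y m} → 2 ≤ m →
                    Path (AddEdge R u v) x y m → ¬ R y x → AddEdge R u v y x → Path R u v m
  drop-added-edge R-sym 2≤m P ¬yx (inj₁ yx) = ⊥-elim (¬yx yx)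
  drop-added-edge R-sym {m = m} 2≤m P ¬yx (inj₂ (inj₁ (refl , refl))) = reverse R-sym (restrict P step)
    where
    step : ∀ {t} → t < m → R (at P t) (at P (suc t))
    step t<m with at-step P t<m
    ... | inj₁ r                  = r
    ... | inj₂ (inj₁ (t≡y , _))   = ⊥-elim (no-step-from-end P t<m t≡y)
    ... | inj₂ (inj₂ (t≡x , t′≡y)) = ⊥-elim (no-shortcut P 2≤m t<m t≡x t′≡y)
  drop-added-edge R-sym {m = m} 2≤m P ¬yx (inj₂ (inj₂ (refl , refl))) = restrict P step
    where
    step : ∀ {t} → t < m → R (at P t) (at P (suc t))
    step t<m with at-step P t<m
    ... | inj₁ r                  = r
    ... | inj₂ (inj₁ (t≡x , t′≡y)) = ⊥-elim (no-shortcut P 2≤m t<m t≡x t′≡y)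
    ... | inj₂ (inj₂ (t≡y , _))   = ⊥-elim (no-step-from-end P t<m t≡y)

toℕ-mod : ∀ {m t} → t ≤ m → toℕ (t mod suc m) ≡ t
toℕ-mod t≤m = trans (toℕ-fromℕ< _) (m≤n⇒m%n≡m t≤m)

module _ {A : Set} {R : A → A → Set} where

  close : ∀ {x y m} (P : Path R x y m) → 2 ≤ m → R y x → IsCycle R (suc m) (at P ∘ toℕ)
  close {m = m} P 2≤m yx =
    s≤s 2≤m , (λ {i} {j} eq → toℕ-injective (at-injective P (s≤s⁻¹ (toℕ<n i)) (s≤s⁻¹ (toℕ<n j)) eq)) , edges
    where
    edges : ∀ i j → Consec (suc m) i j → R (at P (toℕ i)) (at P (toℕ j))
    edges i j (inj₁ e) =
      subst (λ k → R (at P (toℕ i)) (at P k)) e (at-step P (s≤s⁻¹ (subst (_< suc m) (sym e) (toℕ<n j))))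
    edges i j (inj₂ (e₁ , e₂)) =
      subst₂ R (sym (trans (cong (at P) (suc-injective e₁)) (at-end P))) (sym (trans (cong (at P) e₂) (at-start P))) yx

  closing-cycEdge : ∀ {x y m} (P : Path R x y m) → CycEdge (at P ∘ toℕ) y x
  closing-cycEdge {m = m} P =
    fromℕ m , fzero , inj₂ (cong suc (toℕ-fromℕ m) , refl) ,
    inj₁ (trans (cong (at P) (toℕ-fromℕ m)) (at-end P) , at-start P)

  step-cycEdge : ∀ {x y m} (P : Path R x y m) {t} → t < m → CycEdge (at P ∘ toℕ) (at P t) (at P (suc t))
  step-cycEdge {m = m} P {t} t<m =
    fromℕ< t<m′ , fromℕ< (s≤s t<m) ,
    inj₁ (trans (cong suc (toℕ-fromℕ< t<m′)) (sym (toℕ-fromℕ< (s≤s t<m)))) ,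
    inj₁ (cong (at P) (toℕ-fromℕ< t<m′) , cong (at P) (toℕ-fromℕ< (s≤s t<m)))
    where
    t<m′ : t < suc m
    t<m′ = m<n⇒m<1+n t<m

  cycle-path : ∀ {m g} → IsCycle R (suc m) g → Path R (g fzero) (g (fromℕ m)) m
  cycle-path {m} {g} (_ , g-injective , g-edges) = record
    { at           = λ t → g (t mod suc m)
    ; at-start     = refl
    ; at-end       = cong g (toℕ-injective (trans (toℕ-mod ≤-refl) (sym (toℕ-fromℕ m))))
    ; at-injective = λ s≤m t≤m eq →
        trans (sym (toℕ-mod s≤m)) (trans (cong toℕ (g-injective eq)) (toℕ-mod t≤m))
    ; at-step      = λ t<m → g-edges _ _ (inj₁ (trans (cong suc (toℕ-mod (<⇒≤ t<m))) (sym (toℕ-mod t<m))))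
    }

  cycle-closing : ∀ {m g} → IsCycle R (suc m) g → R (g (fromℕ m)) (g fzero)
  cycle-closing {m} (_ , _ , g-edges) = g-edges _ _ (inj₂ (cong suc (toℕ-fromℕ m) , refl))

module _ {A : Set} {q : ℕ} {g : Fin q → A} where

  cycEdge-sym : ∀ {x y} → CycEdge g x y → CycEdge g y x
  cycEdge-sym (i , j , c , inj₁ ends) = i , j , c , inj₂ ends
  cycEdge-sym (i , j , c , inj₂ ends) = i , j , c , inj₁ ends

  cycEdge-endpoints : ∀ {x y} → CycEdge g x y → (∃[ i ] g i ≡ x) × (∃[ j ] g j ≡ y)
  cycEdge-endpoints (i , j , _ , inj₁ (gi≡x , gj≡y)) = (i , gi≡x) , (j , gj≡y)
  cycEdge-endpoints (i , j , _ , inj₂ (gi≡y , gj≡x)) = (j , gj≡x) , (i , gi≡y)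

  module _ {R : A → A → Set} where

    cycEdge-cycle : IsCycle R q g → IsCycle (CycEdge g) q g
    cycEdge-cycle (3≤q , g-injective , _) = 3≤q , g-injective , λ i j c → i , j , c , inj₁ (refl , refl)

    cycEdge⇒R : (∀ {a b} → R a b → R b a) → IsCycle R q g → ∀ {x y} → CycEdge g x y → R x y
    cycEdge⇒R R-sym (_ , _ , edges) (i , j , c , inj₁ (refl , refl)) = edges i j c
    cycEdge⇒R R-sym (_ , _ , edges) (i , j , c , inj₂ (refl , refl)) = R-sym (edges i j c)

-- Saturated graphs

module _ {n : ℕ} (G : Graph n) where

  E-sym : ∀ {x y} → E G x y → E G y x
  E-sym {x} {y} = subst T (Graph.sym G x y)

  E-irrefl : ∀ {x y} → E G x y → x ≢ y
  E-irrefl {x} e refl = subst T (Graph.irrefl G x) e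

  -- The C₅ of G + uv has an edge outside G, which can only be uv; the rest of it is a u–v path in G.
  saturated-path : Saturated G → ∀ {u v} → KAdj u v → ¬ E G u v → Path (E G) u v 4
  saturated-path (no-C₅ , saturated) {u} {v} uv-allowed ¬uv =
    let h , h-cycle = saturated u v uv-allowed ¬uv
    in remove-uv (cycle-path {R = AddEdge (E G) u v} h-cycle) (cycle-closing {R = AddEdge (E G) u v} h-cycle)
    where
    2≤4 : 2 ≤ 4
    2≤4 = s≤s (s≤s z≤n)
    remove-uv : ∀ {x y} (P : Path (AddEdge (E G) u v) x y 4) → AddEdge (E G) u v y x → Path (E G) u v 4
    remove-uv {x} {y} P closing with anyUpTo? (λ t → ¬? (T? (adj G (at P t) (at P (suc t))))) 4
    ... | yes (t , t<4 , ¬step) = drop-added-edge E-sym 2≤4 (rotate P closing t<4) ¬step (at-step P t<4)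
    ... | no all-steps with T? (adj G y x)
    ...   | no ¬yx = drop-added-edge E-sym 2≤4 P ¬yx closing
    ...   | yes yx = ⊥-elim (no-C₅ (_ , close (restrict P steps) 2≤4 yx))
      where
      steps : ∀ {t} → t < 4 → E G (at P t) (at P (suc t))
      steps t<4 = decidable-stable (T? _) (λ ¬step → all-steps (_ , t<4 , ¬step))

Isolated : ∀ {n} → Graph n → ∀ {p} → (Fin p → V n) → Set
Isolated {n} G f = ∀ u v → CycEdge f u v →
  ∀ (q : ℕ) (g : Fin q → V n) → IsCycle (E G) q g → CycEdge g u v →
  ∀ x y → (CycEdge f x y → CycEdge g x y) × (CycEdge g x y → CycEdge f x y)

-- The cycle has length suc p here, one more than the parameter p.
module IsolatedCycle {n : ℕ} (G : Graph n) {p : ℕ} (f : Fin (suc p) → V n)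
                     (f-cycle : IsCycle (E G) (suc p) f) (isolated : Isolated G f) where

  C : Path (CycEdge f) (f fzero) (f (fromℕ p)) p
  C = cycle-path (cycEdge-cycle {R = E G} f-cycle)

  F : ℕ → V n
  F = at C

  F-injective : ∀ {a b} → a ≤ p → b ≤ p → F a ≡ F b → a ≡ b
  F-injective = at-injective C

  F-toℕ : ∀ γ → F (toℕ γ) ≡ f γ
  F-toℕ γ = cong f (toℕ-injective (toℕ-mod (s≤s⁻¹ (toℕ<n γ))))

  toℕ-position : ∀ {γ a} → a ≤ p → f γ ≡ F a → toℕ γ ≡ a
  toℕ-position {γ} a≤p fγ≡Fa = F-injective (s≤s⁻¹ (toℕ<n γ)) a≤p (trans (F-toℕ γ) fγ≡Fa)

  OnCycle : V n → Set
  OnCycle x = ∃[ γ ] f γ ≡ x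

  onCycle? : Decidable OnCycle
  onCycle? x = any? (λ γ → ≡-dec _≟ᶠ_ _≟ᶠ_ (f γ) x)

  onCycle-F : ∀ a → OnCycle (F a)
  onCycle-F a = a mod suc p , refl

  cycEdge⇒E : ∀ {x y} → CycEdge f x y → E G x y
  cycEdge⇒E = cycEdge⇒R {R = E G} (E-sym G) f-cycle

  cycEdge⇒cyclicAdj : ∀ {a b} → a ≤ p → b ≤ p → CycEdge f (F a) (F b) → CyclicAdj (suc p) a b
  cycEdge⇒cyclicAdj a≤p b≤p (i , j , c , inj₁ (fi≡Fa , fj≡Fb)) =
    inj₁ (subst₂ (CyclicSucc (suc p)) (toℕ-position a≤p fi≡Fa) (toℕ-position b≤p fj≡Fb) c)
  cycEdge⇒cyclicAdj a≤p b≤p (i , j , c , inj₂ (fi≡Fb , fj≡Fa)) =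
    inj₂ (subst₂ (CyclicSucc (suc p)) (toℕ-position b≤p fi≡Fb) (toℕ-position a≤p fj≡Fa) c)

  segment : ∀ {α β} → toℕ α < toℕ β → Path (CycEdge f) (f α) (f β) (suc (toℕ β ∸ suc (toℕ α)))
  segment {α} {β} α<β =
    cast (F-toℕ α) (trans (cong F a+1+d≡b) (F-toℕ β)) (slice C (toℕ α) _ (subst (_≤ p) (sym a+1+d≡b) (s≤s⁻¹ (toℕ<n β))))
    where
    a+1+d≡b : toℕ α + suc (toℕ β ∸ suc (toℕ α)) ≡ toℕ β
    a+1+d≡b = trans (+-suc (toℕ α) _) (m+[n∸m]≡n α<β)

  arc : ∀ γ δ → γ ≢ δ → ∃[ d ] Path (CycEdge f) (f γ) (f δ) (suc d)
  arc γ δ γ≢δ with <-cmp (toℕ γ) (toℕ δ)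
  ... | tri< γ<δ _ _ = _ , segment γ<δ
  ... | tri≈ _ γ≡δ _ = ⊥-elim (γ≢δ (toℕ-injective γ≡δ))
  ... | tri> _ _ δ<γ = _ , reverse cycEdge-sym (segment δ<γ)

  module _ {x y m} (w : Path (E G) x y (suc m)) (interior-off : ∀ {s} → s < m → ¬ OnCycle (at w (suc s)))
           (first-off : ¬ CycEdge f x (at w 1)) where

    -- The ear followed by the arc back is a cycle sharing the first edge of the arc with C,
    -- so its closing edge x → w₁ would have to be an edge of C.
    ear-cycle : ∀ {d} → Path (CycEdge f) y x (suc d) → 2 ≤ m + suc d → ⊥
    ear-cycle {d} back long =
      first-off (proj₂ (isolated _ _ (at-step back (s≤s z≤n)) _ _ (close loop long closing) back-edge x (at w 1))
                       (closing-cycEdge loop))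
      where
      tail : Path (E G) (at w 1) y m
      tail = cast refl (at-end w) (slice w 1 m ≤-refl)
      back′ : Path (E G) y x (suc d)
      back′ = restrict back (cycEdge⇒E ∘ at-step back)
      disjoint : Disjoint tail back′
      disjoint {s} {suc t} s<m _ t<1+d eq =
        interior-off s<m (subst OnCycle (sym eq) (proj₂ (cycEdge-endpoints (at-step back t<1+d))))
      loop : Path (E G) (at w 1) x (m + suc d)
      loop = concat tail back′ disjoint
      closing : E G x (at w 1)
      closing = subst (λ z → E G z (at w 1)) (at-start w) (at-step w (s≤s z≤n))
      back-edge : CycEdge (at loop ∘ toℕ) (at back 0) (at back 1)
      back-edge = subst₂ (CycEdge (at loop ∘ toℕ)) (at-concatʳ tail back′ disjoint 0)
        (trans (cong (at loop) (sym (+-suc m 0))) (at-concatʳ tail back′ disjoint 1))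
        (step-cycEdge loop (+-monoʳ-< m (s≤s z≤n)))

  ear-closed-by : ∀ {x y m d} (w : Path (E G) x y (suc m)) →
                  (∀ {s} → s < m → ¬ OnCycle (at w (suc s))) → ¬ CycEdge f x (at w 1) →
                  Path (CycEdge f) y x (suc d) → ⊥
  ear-closed-by {m = suc m} {d} w interior-off first-off back =
    ear-cycle w interior-off first-off back (s≤s (≤-trans (s≤s z≤n) (m≤n+m (suc d) m)))
  ear-closed-by {m = zero} {suc d} w interior-off first-off back =
    ear-cycle w interior-off first-off back (s≤s (s≤s z≤n))
  ear-closed-by {x} {m = zero} {zero} w _ first-off back =
    first-off (subst (CycEdge f x) (sym (at-end w))
      (cycEdge-sym (subst₂ (CycEdge f) (at-start back) (at-end back) (at-step back (s≤s z≤n)))))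

  no-ear : ∀ {x y m} (w : Path (E G) x y (suc m)) → OnCycle x → OnCycle y →
           (∀ {s} → s < m → ¬ OnCycle (at w (suc s))) → ¬ CycEdge f x (at w 1) → ⊥
  no-ear w (γ , refl) (δ , refl) interior-off first-off =
    ear-closed-by w interior-off first-off (proj₂ (arc δ γ (ends-distinct w ∘ sym ∘ cong f)))

  chord-adjacent : ∀ {a b} → a ≤ p → b ≤ p → E G (F a) (F b) → CyclicAdj (suc p) a b
  chord-adjacent {a} {b} a≤p b≤p e with cyclicAdj? (suc p) a b
  ... | yes adjacent = adjacent
  ... | no ¬adjacent = ⊥-elim (no-ear (edge (E-irrefl G e) e) (onCycle-F a) (onCycle-F b) (λ ())
                                     (¬adjacent ∘ cycEdge⇒cyclicAdj a≤p b≤p))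

  path-on-cycle : ∀ {x y m} (w : Path (E G) x y m) → OnCycle x → OnCycle y → ∀ {t} → t ≤ m → OnCycle (at w t)
  path-on-cycle w on-x on-y {zero} _ = subst OnCycle (sym (at-start w)) on-x
  path-on-cycle {m = m} w on-x on-y {suc t} t<m with onCycle? (at w (suc t))
  ... | yes on = on
  -- Otherwise w leaves C after t; up to its first return to C it is an ear.
  ... | no off with first-hit (onCycle? ∘ at w) (suc t) (m ∸ suc t)
                     (subst OnCycle (sym (trans (cong (at w) (m+[n∸m]≡n t<m)) (at-end w))) on-y)
  ...   | zero  , _   , on , _      = ⊥-elim (off (subst (OnCycle ∘ at w) (+-identityʳ (suc t)) on))
  ...   | suc d , d<k , on , before =
    ⊥-elim (no-ear ear (path-on-cycle w on-x on-y (<⇒≤ t<m)) (subst (OnCycle ∘ at w) (sym (+-suc t (suc d))) on)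
                   (λ {s} s<d → before s<d ∘ subst (OnCycle ∘ at w) (+-suc t s))
                   (off ∘ subst (OnCycle ∘ at w) (+-comm t 1) ∘ proj₂ ∘ cycEdge-endpoints))
    where
    ear : Path (E G) (at w t) (at w (t + suc (suc d))) (suc (suc d))
    ear = slice w t (suc (suc d))
            (subst (_≤ m) (sym (+-suc t (suc d))) (subst (suc t + suc d ≤_) (m+[n∸m]≡n t<m) (+-monoʳ-≤ (suc t) d<k)))

  position : V n → ℕ
  position x with onCycle? x
  ... | yes (γ , _) = toℕ γ
  ... | no _        = 0

  position-≤ : ∀ x → position x ≤ p
  position-≤ x with onCycle? x
  ... | yes (γ , _) = s≤s⁻¹ (toℕ<n γ)
  ... | no _        = z≤n

  F-position : ∀ {x} → OnCycle x → F (position x) ≡ x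
  F-position {x} on with onCycle? x
  ... | yes (γ , fγ≡x) = trans (F-toℕ γ) fγ≡x
  ... | no off         = ⊥-elim (off on)

  position-F : ∀ {a} → a ≤ p → position (F a) ≡ a
  position-F {a} a≤p = F-injective (position-≤ (F a)) a≤p (F-position (onCycle-F a))

  position-walk : ∀ {x y m} (w : Path (E G) x y m) → OnCycle x → OnCycle y →
                  NonBacktrackingWalk (suc p) m (position ∘ at w)
  position-walk {m = m} w on-x on-y = record
    { bounded          = λ _ → s≤s (position-≤ _)
    ; adjacent         = λ t<m → chord-adjacent (position-≤ _) (position-≤ _)
                           (subst₂ (E G) (sym (F-position (on (<⇒≤ t<m)))) (sym (F-position (on t<m))) (at-step w t<m))
    ; non-backtracking = λ {t} 2+t≤m eq →
                           <-irrefl (sym (position-injective 2+t≤m (≤-trans (n≤1+n t) (<⇒≤ 2+t≤m)) eq))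
                                    (m<n⇒m<1+n (n<1+n t))
    }
    where
    on : ∀ {t} → t ≤ m → OnCycle (at w t)
    on = path-on-cycle w on-x on-y
    position-injective : ∀ {s t} → s ≤ m → t ≤ m → position (at w s) ≡ position (at w t) → s ≡ t
    position-injective s≤m t≤m eq =
      at-injective w s≤m t≤m (trans (sym (F-position (on s≤m))) (trans (cong F eq) (F-position (on t≤m))))

  no-short-detour : 7 ≤ p → ∀ {k} → k ≤ 3 → ¬ Path (E G) (F 0) (F k) 4
  no-short-detour 7≤p {k} k≤3 w = impossible (walk-displacement (position-walk w (onCycle-F 0) (onCycle-F k))
    (subst (λ i → i + 4 < suc p) (sym x₀≡0) (s≤s (≤-trans 4≤7 7≤p)))
    (subst (λ i → i + 4 < suc p) (sym x₄≡k) (s≤s (≤-trans (+-monoˡ-≤ 4 k≤3) 7≤p))))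
    where
    4≤7 : 4 ≤ 7
    4≤7 = s≤s (s≤s (s≤s (s≤s z≤n)))
    x₀≡0 : position (at w 0) ≡ 0
    x₀≡0 = trans (cong position (at-start w)) (position-F z≤n)
    x₄≡k : position (at w 4) ≡ k
    x₄≡k = trans (cong position (at-end w)) (position-F (≤-trans k≤3 (≤-trans (n≤1+n 3) (≤-trans 4≤7 7≤p))))
    impossible : position (at w 4) ≡ position (at w 0) + 4 ⊎ position (at w 0) ≡ position (at w 4) + 4 → ⊥
    impossible (inj₁ x₄≡x₀+4) = <⇒≱ (s≤s k≤3) (≤-reflexive (trans (sym (trans x₄≡x₀+4 (cong (_+ 4) x₀≡0))) x₄≡k))
    impossible (inj₂ x₀≡x₄+4) = 0≢1+n (sym (m+n≡0⇒n≡0 k (trans (cong (_+ 4) (sym x₄≡k)) (trans (sym x₀≡x₄+4) x₀≡0))))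

  same-part-as-F₀ : Saturated G → 7 ≤ p → ∀ {k} → 2 ≤ k → k ≤ 3 → ¬ KAdj (F 0) (F k)
  same-part-as-F₀ saturated 7≤p {k} 2≤k k≤3 allowed with T? (adj G (F 0) (F k))
  ... | yes chord = not-adjacent-to-0 2≤k k<p (chord-adjacent z≤n (<⇒≤ k<p) chord)
    where
    k<p : k < p
    k<p = ≤-trans (s≤s k≤3) (≤-trans (s≤s (s≤s (s≤s (s≤s z≤n)))) 7≤p)
  ... | no ¬chord = no-short-detour 7≤p k≤3 (saturated-path G saturated allowed ¬chord)

lemma5p6 : (n : ℕ) → 1 ≤ n → (G : Graph n) → Spanning G → Saturated G →
    ((H : Graph n) → Spanning H → Saturated H → numEdges G ≤ numEdges H) →
    (p : ℕ) (f : Fin p → V n) → IsCycle (E G) p f →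
    (∀ u v → CycEdge f u v →
      ∀ (q : ℕ) (g : Fin q → V n) → IsCycle (E G) q g → CycEdge g u v →
      ∀ x y → (CycEdge f x y → CycEdge g x y) × (CycEdge g x y → CycEdge f x y)) →
    p ≤ 7
lemma5p6 n _ G spanning saturated _ zero    f cycle isolated = z≤n
lemma5p6 n _ G spanning saturated _ (suc p) f cycle isolated with suc p ≤? 7
... | yes p≤7 = p≤7
... | no  p≰7 = ⊥-elim (spanning (F 2) (F 3) (cycEdge⇒E (at-step C 2<p)) (trans (sym F₀~F₂) F₀~F₃))
  where
  open IsolatedCycle G f cycle isolated
  7≤p : 7 ≤ p
  7≤p = s≤s⁻¹ (≰⇒> p≰7)
  2<p : 2 < p
  2<p = ≤-trans (s≤s (s≤s (s≤s z≤n))) 7≤p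
  same-part : ∀ {k} → 2 ≤ k → k ≤ 3 → proj₁ (F 0) ≡ proj₁ (F k)
  same-part {k} 2≤k k≤3 = decidable-stable (proj₁ (F 0) ≟ᶠ proj₁ (F k)) (same-part-as-F₀ saturated 7≤p 2≤k k≤3)
  F₀~F₂ : proj₁ (F 0) ≡ proj₁ (F 2)
  F₀~F₂ = same-part ≤-refl (n≤1+n 2)
  F₀~F₃ : proj₁ (F 0) ≡ proj₁ (F 3)
  F₀~F₃ = same-part (n≤1+n 2) ≤-refl
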